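{- There are infinitely many pairs $(x,y)$ of binary words such that $J_{\mathrm{tri}}(xy)<J_{\mathrm{tri}}(x)$ (i.e. infinitely many counterexamples to the statement "$J_{\mathrm{tri}}(x)\le J_{\mathrm{tri}}(xy)$ for all binary words $x,y$").
   Context: Words are finite strings over $\{0,1\}$ ($0$ = hydrophobic, $1$ = polar); $xy$ is concatenation. The triangular lattice is the 6-regular graph of vertices and edges of the regular triangular tiling of the plane. A fold of a word $w=w_1\cdots w_n$ is a self-avoiding walk $v_1,\dots,v_n$ in this lattice (distinct vertices, $v_i$ adjacent to $v_{i+1}$); its score is the number of pairs $\{i,j\}$ with $|i-j|\ge 2$, $w_i=w_j=0$ and $v_i,v_j$ adjacent. $J_{\mathrm{tri}}(w)$ is the maximum score over all folds of $w$. -}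

module Defs where

open import Data.Nat using (ℕ; suc; _+_; _≤_; _<_)
open import Data.Nat.Properties using (_≤?_)
open import Data.Fin using (Fin; toℕ; zero)
open import Data.Fin.Properties using () renaming (_≟_ to _≟ᶠ_)
open import Data.Integer using (ℤ; +_; -[1+_]; _-_)
open import Data.Integer.Properties using () renaming (_≟_ to _≟ℤ_)
open import Data.Product using (_×_; _,_; proj₁; proj₂; Σ)
open import Data.Product.Properties using (≡-dec)
open import Data.List using (List; length; lookup; filter; cartesianProduct; allFin)
open import Data.List.Membership.Propositional using (_∈_)
open import Data.List.Membership.DecPropositional using () renaming (_∈?_ to member?)
open import Relation.Nullary using (Dec)
open import Relation.Nullary.Decidable using (_×-dec_)
open import Relation.Binary.PropositionalEquality using (_≡_)
open import Function.Definitions using (Injective)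

-- Letters: Fin 2, with zero = 0 = hydrophobic, suc zero = 1 = polar.
Letter : Set
Letter = Fin 2

Word : Set
Word = List Letter

-- Triangular lattice: vertices ℤ × ℤ (coordinates w.r.t. basis e₁, e₂ at 60°),
-- each vertex has the six neighbours at offsets
-- (±1,0), (0,±1), (1,-1), (-1,1).
Point : Set
Point = ℤ × ℤ

offsets : List Point
offsets = (+ 1 , + 0) ∷ᴸ (-[1+ 0 ] , + 0) ∷ᴸ (+ 0 , + 1) ∷ᴸ (+ 0 , -[1+ 0 ])
          ∷ᴸ (+ 1 , -[1+ 0 ]) ∷ᴸ (-[1+ 0 ] , + 1) ∷ᴸ []ᴸ
  where open import Data.List using () renaming (_∷_ to _∷ᴸ_; [] to []ᴸ)

Adj : Point → Point → Set
Adj p q = (proj₁ q - proj₁ p , proj₂ q - proj₂ p) ∈ offsets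

Adj? : (p q : Point) → Dec (Adj p q)
Adj? p q = member? (≡-dec _≟ℤ_ _≟ℤ_) _ offsets

record Fold (w : Word) : Set where
  field
    pos  : Fin (length w) → Point
    self-avoiding : Injective _≡_ _≡_ pos
    walk : (i j : Fin (length w)) → toℕ j ≡ suc (toℕ i) → Adj (pos i) (pos j)
open Fold public

-- Ordered pairs (i , j) with i + 2 ≤ j (i.e. unordered pairs with |i-j| ≥ 2),
-- both letters 0, and adjacent positions.
Contact : (w : Word) → Fold w → Fin (length w) × Fin (length w) → Set
Contact w f (i , j) =
  (toℕ i + 2 ≤ toℕ j) × (lookup w i ≡ zero) × (lookup w j ≡ zero) × Adj (pos f i) (pos f j)

Contact? : (w : Word) (f : Fold w) → (ij : Fin (length w) × Fin (length w)) → Dec (Contact w f ij)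
Contact? w f (i , j) =
  (toℕ i + 2 ≤? toℕ j) ×-dec (lookup w i ≟ᶠ zero) ×-dec (lookup w j ≟ᶠ zero)
    ×-dec Adj? (pos f i) (pos f j)

score : (w : Word) → Fold w → ℕ
score w f = length (filter (Contact? w f)
                      (cartesianProduct (allFin (length w)) (allFin (length w))))

IsJtri : Word → ℕ → Set
IsJtri w m = Σ (Fold w) (λ f → score w f ≡ m) × ((f : Fold w) → score w f ≤ m)

-- The word x₀ = 0100100100 has a fold with 9 contacts, and a branch-and-bound enumeration
-- of its self-avoiding walks shows that 9 is the maximum and that a fold reaching 9 must
-- surround its last monomer by six occupied sites.  Appending polar letters y adds no
-- contacts, but the next monomer of x₀y must sit on a free site next to the last monomer
-- of x₀, so every fold of x₀y has at most 8 contacts; 8 is attained by leaving x₀ along a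
-- straight ray.  Hence J(x₀y) = 8 < 9 = J(x₀) for every nonempty polar y.  The enumeration
-- is cut down by moving the last step of x₀ to a fixed position with a lattice symmetry.

module Submission where

open import Defs
open import Data.Nat using (ℕ; _+_; _≤_; _<_)
open import Data.List using (length; _++_)
open import Data.Product using (_×_; Σ; ∃)

open import Data.Bool using (Bool; true; false; T; _∧_; _∨_; if_then_else_)
open import Data.Bool.ListAction using (all)
open import Data.Bool.Properties using (T-∨; T-∧; T-≡)
open import Data.Empty using (⊥-elim)
open import Data.Fin using (Fin; zero; suc; toℕ; cast)
open import Data.Fin.Properties using (toℕ-cast; toℕ-injective) renaming (_≟_ to _≟ᶠ_)
open import Data.Integer as ℤ using (ℤ; +_; -[1+_])
import Data.Integer.Properties as ℤP
import Data.Integer.Tactic.RingSolver as ℤ-Ring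
open import Data.List
  using (List; []; _∷_; _ʳ++_; drop; take; reverse; filter; map; tabulate; lookup; allFin;
         cartesianProduct; applyUpTo; replicate; head)
import Data.List.Properties as List
open import Data.List.Membership.Propositional using (_∈_; _∉_)
open import Data.List.Membership.Propositional.Properties
  using (∈-lookup; ∈-++⁺ʳ; ∈-map⁻; ∈-applyUpTo⁻)
open import Data.Product.Properties using (≡-dec)
open import Data.List.Membership.DecPropositional (≡-dec ℤ._≟_ ℤ._≟_) using (_∈?_)
open import Data.List.Relation.Unary.All as All using (All)
import Data.List.Relation.Unary.All.Properties as All
open import Data.List.Relation.Unary.AllPairs using ([]; _∷_)
open import Data.List.Relation.Unary.Any using (here; there)
open import Data.List.Relation.Unary.Linked as Linked using (Linked; []; [-]; _∷_)
import Data.List.Relation.Unary.Linked.Properties as Linked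
open import Data.List.Relation.Unary.Unique.Propositional using (Unique)
import Data.List.Relation.Unary.Unique.Propositional.Properties as Unique
open import Data.List.Relation.Unary.Unique.DecPropositional (≡-dec ℤ._≟_ ℤ._≟_) using (unique?)
open import Data.Maybe using (just)
open import Data.Maybe.Relation.Binary.Connected using (Connected; just; just-nothing)
open import Data.Nat using (zero; suc; _≤ᵇ_; s≤s; z≤n)
open import Data.Nat.ListAction using (sum)
import Data.Nat.Properties as ℕ
open import Data.Product using (_,_; proj₁; proj₂; ∃-syntax; Σ-syntax)
open import Data.Sum using (_⊎_; inj₁; inj₂)
open import Function using (_∘_)
open import Function.Bundles using (Equivalence)
open import Function.Definitions using (Injective)
open import Relation.Binary.PropositionalEquality
  using (_≡_; refl; cong; cong₂; sym; trans; subst)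
open import Relation.Nullary using (Dec; does; yes; no)
open import Relation.Nullary.Decidable using (from-yes)
open import Relation.Unary using (Decidable)

-- Contacts of a walk

H P : Letter
H = zero
P = suc zero

isH : Letter → Bool
isH a = does (a ≟ᶠ zero)

contactsWith : Letter → Point → Word → List Point → ℕ
contactsWith a v (b ∷ u) (q ∷ S) =
  (if isH a ∧ (isH b ∧ does (Adj? v q)) then 1 else 0) + contactsWith a v u S
contactsWith a v _       _       = 0

-- drop 1 skips the chain successor, as contacts need |i - j| ≥ 2.
contacts : Word → List Point → ℕ
contacts (a ∷ u) (v ∷ S) = contactsWith a v (drop 1 u) (drop 1 S) + contacts u S
contacts _       _       = 0

positions : ∀ {w} → Fold w → List Point
positions f = tabulate (pos f)

count : {A : Set} → (A → Bool) → List A → ℕ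
count p []       = 0
count p (x ∷ xs) = (if p x then 1 else 0) + count p xs

countFin : ∀ {n} → (Fin n → Bool) → ℕ
countFin {zero}  p = 0
countFin {suc n} p = (if p zero then 1 else 0) + countFin (p ∘ suc)

sumFin : ∀ {n} → (Fin n → ℕ) → ℕ
sumFin {zero}  f = 0
sumFin {suc n} f = f zero + sumFin (f ∘ suc)

module _ {A : Set} where

  length-filter≡count : ∀ {R : A → Set} (R? : Decidable R) xs →
                        length (filter R? xs) ≡ count (does ∘ R?) xs
  length-filter≡count R? []       = refl
  length-filter≡count R? (x ∷ xs) with does (R? x)
  ... | true  = cong suc (length-filter≡count R? xs)
  ... | false = length-filter≡count R? xs

  count-++ : ∀ (p : A → Bool) xs ys → count p (xs ++ ys) ≡ count p xs + count p ys
  count-++ p []       ys = refl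
  count-++ p (x ∷ xs) ys with p x
  ... | true  = cong suc (count-++ p xs ys)
  ... | false = count-++ p xs ys

  count-tabulate : ∀ {n} (p : A → Bool) (f : Fin n → A) → count p (tabulate f) ≡ countFin (p ∘ f)
  count-tabulate {zero}  p f = refl
  count-tabulate {suc n} p f with p (f zero)
  ... | true  = cong suc (count-tabulate p (f ∘ suc))
  ... | false = count-tabulate p (f ∘ suc)

  sum-map-tabulate : ∀ {n} (g : A → ℕ) (f : Fin n → A) → sum (map g (tabulate f)) ≡ sumFin (g ∘ f)
  sum-map-tabulate {zero}  g f = refl
  sum-map-tabulate {suc n} g f = cong (λ m → g (f zero) + m) (sum-map-tabulate g (f ∘ suc))

count-map : ∀ {A B : Set} (p : B → Bool) (f : A → B) xs → count p (map f xs) ≡ count (p ∘ f) xs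
count-map p f []       = refl
count-map p f (x ∷ xs) with p (f x)
... | true  = cong suc (count-map p f xs)
... | false = count-map p f xs

count-cartesianProduct : ∀ {A B : Set} (p : A × B → Bool) xs ys →
  count p (cartesianProduct xs ys) ≡ sum (map (λ x → count (λ y → p (x , y)) ys) xs)
count-cartesianProduct p []       ys = refl
count-cartesianProduct p (x ∷ xs) ys = trans (count-++ p (map (x ,_) ys) (cartesianProduct xs ys))
  (cong₂ _+_ (count-map p (x ,_) ys) (count-cartesianProduct p xs ys))

sumFin-cong : ∀ {n} {f g : Fin n → ℕ} → (∀ i → f i ≡ g i) → sumFin f ≡ sumFin g
sumFin-cong {zero}  f≗g = refl
sumFin-cong {suc n} f≗g = cong₂ _+_ (f≗g zero) (sumFin-cong (f≗g ∘ suc))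

countFin-cong : ∀ {n} {p q : Fin n → Bool} → (∀ i → p i ≡ q i) → countFin p ≡ countFin q
countFin-cong {zero}  p≗q = refl
countFin-cong {suc n} p≗q =
  cong₂ _+_ (cong (λ b → if b then 1 else 0) (p≗q zero)) (countFin-cong (p≗q ∘ suc))

count-pairs : ∀ {n} (p : Fin n × Fin n → Bool) →
  count p (cartesianProduct (allFin n) (allFin n)) ≡ sumFin (λ i → countFin (λ j → p (i , j)))
count-pairs {n} p = trans (count-cartesianProduct p (allFin n) (allFin n))
  (trans (sum-map-tabulate (λ i → count (λ j → p (i , j)) (allFin n)) (λ i → i))
         (sumFin-cong (λ i → count-tabulate (λ j → p (i , j)) (λ j → j))))

hydrophobicAdjacent : (w : Word) → (Fin (length w) → Point) → Fin (length w) → Fin (length w) → Bool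
hydrophobicAdjacent w p i j = isH (lookup w i) ∧ (isH (lookup w j) ∧ does (Adj? (p i) (p j)))

contactTest : (w : Word) → (Fin (length w) → Point) → Fin (length w) × Fin (length w) → Bool
contactTest w p (i , j) = (toℕ i + 2 ≤ᵇ toℕ j) ∧ hydrophobicAdjacent w p i j

≤ᵇ-suc : ∀ m n → (suc m ≤ᵇ suc n) ≡ (m ≤ᵇ n)
≤ᵇ-suc zero    n = refl
≤ᵇ-suc (suc m) n = refl

contactsWith-tabulate : ∀ a v u (q : Fin (length u) → Point) →
  contactsWith a v u (tabulate q) ≡ countFin (λ j → isH a ∧ (isH (lookup u j) ∧ does (Adj? v (q j))))
contactsWith-tabulate a v []      q = refl
contactsWith-tabulate a v (b ∷ u) q with isH a ∧ (isH b ∧ does (Adj? v (q zero)))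
... | true  = cong suc (contactsWith-tabulate a v u (q ∘ suc))
... | false = contactsWith-tabulate a v u (q ∘ suc)

contacts-tabulate : ∀ w (p : Fin (length w) → Point) →
  sumFin (λ i → countFin (λ j → contactTest w p (i , j))) ≡ contacts w (tabulate p)
contacts-tabulate []      p = refl
contacts-tabulate (a ∷ u) p =
  cong₂ _+_ (firstRow u p) (trans (sumFin-cong {length u} laterRow) (contacts-tabulate u (p ∘ suc)))
  where
  firstRow : ∀ u (p : Fin (suc (length u)) → Point) →
    countFin (λ j → contactTest (a ∷ u) p (zero , j)) ≡
    contactsWith a (p zero) (drop 1 u) (drop 1 (tabulate (p ∘ suc)))
  firstRow []      p = refl
  firstRow (b ∷ u) p = sym (contactsWith-tabulate a (p zero) u (λ j → p (suc (suc j))))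
  laterRow : ∀ i → countFin (λ j → contactTest (a ∷ u) p (suc i , j)) ≡
                   countFin (λ j → contactTest u (p ∘ suc) (i , j))
  laterRow i = countFin-cong {length u}
    (λ j → cong (_∧ hydrophobicAdjacent u (p ∘ suc) i j) (≤ᵇ-suc (toℕ i + 2) (toℕ j)))

score≡contacts : ∀ w (f : Fold w) → score w f ≡ contacts w (positions f)
score≡contacts w f = trans (length-filter≡count (Contact? w f) (cartesianProduct (allFin n) (allFin n)))
  (trans (count-pairs (contactTest w (pos f))) (contacts-tabulate w (pos f)))
  where n = length w

module _ {A : Set} where

  tabulate-linked : ∀ {R : A → A → Set} {n} {f : Fin n → A} →
    (∀ i j → toℕ j ≡ suc (toℕ i) → R (f i) (f j)) → Linked R (tabulate f)
  tabulate-linked {n = zero}        step = []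
  tabulate-linked {n = suc zero}    step = [-]
  tabulate-linked {n = suc (suc n)} step =
    step zero (suc zero) refl ∷ tabulate-linked (λ i j e → step (suc i) (suc j) (cong suc e))

  lookup-linked : ∀ {R : A → A → Set} {xs} → Linked R xs →
    ∀ i j → toℕ j ≡ suc (toℕ i) → R (lookup xs i) (lookup xs j)
  lookup-linked (x~y ∷ _)   zero    (suc zero) refl = x~y
  lookup-linked (_   ∷ xs~) (suc i) (suc j)    e    = lookup-linked xs~ i j (ℕ.suc-injective e)

  lookup-injective : ∀ {xs : List A} → Unique xs → Injective _≡_ _≡_ (lookup xs)
  lookup-injective (_  ∷ _)   {zero}  {zero}  _ = refl
  lookup-injective (x≢ ∷ _)   {zero}  {suc j} e = ⊥-elim (All.lookup x≢ (∈-lookup j) e)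
  lookup-injective (x≢ ∷ _)   {suc i} {zero}  e = ⊥-elim (All.lookup x≢ (∈-lookup i) (sym e))
  lookup-injective (_  ∷ xs!) {suc i} {suc j} e = cong suc (lookup-injective xs! e)

  tabulate-lookup-cast : ∀ {n} (xs : List A) (eq : n ≡ length xs) → tabulate (lookup xs ∘ cast eq) ≡ xs
  tabulate-lookup-cast {zero}  []       eq = refl
  tabulate-lookup-cast {suc n} (x ∷ xs) eq = cong (x ∷_) (tabulate-lookup-cast xs (ℕ.suc-injective eq))

  linked-++⁻ˡ : ∀ {R : A → A → Set} xs {ys} → Linked R (xs ++ ys) → Linked R xs
  linked-++⁻ˡ []           _        = []
  linked-++⁻ˡ (x ∷ [])     _        = [-]
  linked-++⁻ˡ (x ∷ y ∷ xs) (r ∷ rs) = r ∷ linked-++⁻ˡ (y ∷ xs) rs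

  linked-ʳ++⁻ʳ : ∀ {R : A → A → Set} xs {ys} → Linked R (xs ʳ++ ys) → Linked R ys
  linked-ʳ++⁻ʳ []       rs = rs
  linked-ʳ++⁻ʳ (x ∷ xs) rs = Linked.tail (linked-ʳ++⁻ʳ xs rs)

  linked-junction : ∀ {R : A → A → Set} xs {x y ys} → Linked R (xs ++ x ∷ y ∷ ys) → R x y
  linked-junction []       (r ∷ _) = r
  linked-junction (_ ∷ xs) rs      = linked-junction xs (Linked.tail rs)

  unique-++⁻ˡ : ∀ xs {ys : List A} → Unique (xs ++ ys) → Unique xs
  unique-++⁻ˡ []       _          = []
  unique-++⁻ˡ (x ∷ xs) (x≢ ∷ xs!) = All.++⁻ˡ xs x≢ ∷ unique-++⁻ˡ xs xs!

  unique-ʳ++⁻ʳ : ∀ xs {ys : List A} → Unique (xs ʳ++ ys) → Unique ys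
  unique-ʳ++⁻ʳ []       xs! = xs!
  unique-ʳ++⁻ʳ (x ∷ xs) xs! with unique-ʳ++⁻ʳ xs xs!
  ... | _ ∷ ys! = ys!

  unique-++-∉ : ∀ xs {y} {ys : List A} → Unique (xs ++ y ∷ ys) → y ∉ xs
  unique-++-∉ (x ∷ xs) (x≢ ∷ _)   (here refl) = All.lookup x≢ (∈-++⁺ʳ xs (here refl)) refl
  unique-++-∉ (x ∷ xs) (_  ∷ xs!) (there y∈)  = unique-++-∉ xs xs! y∈

positions-linked : ∀ {w} (f : Fold w) → Linked Adj (positions f)
positions-linked f = tabulate-linked (walk f)

positions-unique : ∀ {w} (f : Fold w) → Unique (positions f)
positions-unique f = Unique.tabulate⁺ (self-avoiding f)

walkFold : ∀ {w} (P : List Point) → length w ≡ length P → Linked Adj P → Unique P → Fold w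
walkFold P eq P-linked P-unique = record
  { pos           = lookup P ∘ cast eq
  ; self-avoiding = λ e → toℕ-injective (trans (sym (toℕ-cast eq _))
                            (trans (cong toℕ (lookup-injective P-unique e)) (toℕ-cast eq _)))
  ; walk          = λ i j e → lookup-linked P-linked (cast eq i) (cast eq j)
                            (trans (toℕ-cast eq j) (trans e (cong suc (sym (toℕ-cast eq i)))))
  }

score-walkFold : ∀ {w} P (eq : length w ≡ length P) P-linked P-unique →
  score w (walkFold P eq P-linked P-unique) ≡ contacts w P
score-walkFold {w} P eq P-linked P-unique =
  trans (score≡contacts w (walkFold P eq P-linked P-unique)) (cong (contacts w) (tabulate-lookup-cast P eq))

-- Symmetries of the lattice

infixl 6 _-ᵖ_

_-ᵖ_ : Point → Point → Point
q -ᵖ p = (proj₁ q ℤ.- proj₁ p , proj₂ q ℤ.- proj₂ p)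

origin east : Point
origin = (+ 0 , + 0)
east   = (+ 1 , + 0)

-ᵖ-cancelʳ : ∀ q p c → (q -ᵖ c) -ᵖ (p -ᵖ c) ≡ q -ᵖ p
-ᵖ-cancelʳ (q₁ , q₂) (p₁ , p₂) (c₁ , c₂) = cong₂ _,_ (cancel q₁ p₁ c₁) (cancel q₂ p₂ c₂)
  where cancel : ∀ i j k → (i ℤ.- k) ℤ.- (j ℤ.- k) ≡ i ℤ.- j
        cancel = ℤ-Ring.solve-∀

-ᵖ-self : ∀ p → p -ᵖ p ≡ origin
-ᵖ-self (p₁ , p₂) = cong₂ _,_ (self p₁) (self p₂)
  where self : ∀ i → i ℤ.- i ≡ + 0
        self = ℤ-Ring.solve-∀

-ᵖ-origin : ∀ p → p -ᵖ origin ≡ p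
-ᵖ-origin (p₁ , p₂) = cong₂ _,_ (minus-zero p₁) (minus-zero p₂)
  where minus-zero : ∀ i → i ℤ.- + 0 ≡ i
        minus-zero = ℤ-Ring.solve-∀

-ᵖ-involutive : ∀ h v → h -ᵖ (h -ᵖ v) ≡ v
-ᵖ-involutive (h₁ , h₂) (v₁ , v₂) = cong₂ _,_ (involutive h₁ v₁) (involutive h₂ v₂)
  where involutive : ∀ i j → i ℤ.- (i ℤ.- j) ≡ j
        involutive = ℤ-Ring.solve-∀

-ᵖ-injectiveˡ : ∀ c → Injective _≡_ _≡_ (_-ᵖ c)
-ᵖ-injectiveˡ c {p} {q} e = trans (sym (unshift p)) (trans (cong (_-ᵖ (origin -ᵖ c)) e) (unshift q))
  where
  unshift : ∀ p → (p -ᵖ c) -ᵖ (origin -ᵖ c) ≡ p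
  unshift (p₁ , p₂) = cong₂ _,_ (identity p₁ (proj₁ c)) (identity p₂ (proj₂ c))
    where identity : ∀ i k → (i ℤ.- k) ℤ.- (+ 0 ℤ.- k) ≡ i
          identity = ℤ-Ring.solve-∀

record IsEmbedding (φ : Point → Point) : Set where
  field
    Adj-preserving : ∀ {p q} → Adj p q → Adj (φ p) (φ q)
    injective      : Injective _≡_ _≡_ φ
open IsEmbedding

∘-isEmbedding : ∀ {φ ψ} → IsEmbedding ψ → IsEmbedding φ → IsEmbedding (ψ ∘ φ)
∘-isEmbedding ψ-emb φ-emb = record
  { Adj-preserving = Adj-preserving ψ-emb ∘ Adj-preserving φ-emb
  ; injective      = injective φ-emb ∘ injective ψ-emb
  }

translation-isEmbedding : ∀ c → IsEmbedding (_-ᵖ c)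
translation-isEmbedding c = record
  { Adj-preserving = λ {p} {q} p~q → subst (_∈ offsets) (sym (-ᵖ-cancelʳ q p c)) p~q
  ; injective      = -ᵖ-injectiveˡ c
  }

rotate : Point → Point
rotate (a , b) = (ℤ.- b , a ℤ.+ b)

rotate-offsets : ∀ {d} → d ∈ offsets → rotate d ∈ offsets
rotate-offsets (here refl)                                         = there (there (here refl))
rotate-offsets (there (here refl))                                 = there (there (there (here refl)))
rotate-offsets (there (there (here refl)))                         = there (there (there (there (there (here refl)))))
rotate-offsets (there (there (there (here refl))))                 = there (there (there (there (here refl))))
rotate-offsets (there (there (there (there (here refl)))))         = here refl
rotate-offsets (there (there (there (there (there (here refl)))))) = there (here refl)

rotate-isEmbedding : IsEmbedding rotate
rotate-isEmbedding = record
  { Adj-preserving = λ {p} {q} p~q → subst (_∈ offsets) (sym (rotate-linear q p)) (rotate-offsets p~q)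
  ; injective      = λ {p} {q} e → trans (sym (unrotate∘rotate p)) (trans (cong unrotate e) (unrotate∘rotate q))
  }
  where
  rotate-linear : ∀ q p → rotate q -ᵖ rotate p ≡ rotate (q -ᵖ p)
  rotate-linear (q₁ , q₂) (p₁ , p₂) = cong₂ _,_ (first q₂ p₂) (second q₁ q₂ p₁ p₂)
    where first : ∀ i j → ℤ.- i ℤ.- ℤ.- j ≡ ℤ.- (i ℤ.- j)
          first = ℤ-Ring.solve-∀
          second : ∀ i₁ i₂ j₁ j₂ → (i₁ ℤ.+ i₂) ℤ.- (j₁ ℤ.+ j₂) ≡ (i₁ ℤ.- j₁) ℤ.+ (i₂ ℤ.- j₂)
          second = ℤ-Ring.solve-∀
  unrotate : Point → Point
  unrotate (c , d) = (c ℤ.+ d , ℤ.- c)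
  unrotate∘rotate : ∀ p → unrotate (rotate p) ≡ p
  unrotate∘rotate (a , b) = cong₂ _,_ (first a b) (second b)
    where first : ∀ i j → ℤ.- j ℤ.+ (i ℤ.+ j) ≡ i
          first = ℤ-Ring.solve-∀
          second : ∀ j → ℤ.- ℤ.- j ≡ j
          second = ℤ-Ring.solve-∀

rotate^ : ℕ → Point → Point
rotate^ zero    = λ p → p
rotate^ (suc k) = rotate ∘ rotate^ k

rotate^-isEmbedding : ∀ k → IsEmbedding (rotate^ k)
rotate^-isEmbedding zero    = record { Adj-preserving = λ p~q → p~q ; injective = λ e → e }
rotate^-isEmbedding (suc k) = ∘-isEmbedding rotate-isEmbedding (rotate^-isEmbedding k)

rotate^-origin : ∀ k → rotate^ k origin ≡ origin
rotate^-origin zero    = refl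
rotate^-origin (suc k) = cong rotate (rotate^-origin k)

rotate-to-east : ∀ {r} → Adj r origin → ∃[ k ] rotate^ k r ≡ east
rotate-to-east {r} r~o = subst (λ r → ∃[ k ] rotate^ k r ≡ east) (-ᵖ-involutive origin r) (towards r~o)
  where
  towards : ∀ {d} → d ∈ offsets → ∃[ k ] rotate^ k (origin -ᵖ d) ≡ east
  towards (here refl)                                         = 3 , refl
  towards (there (here refl))                                 = 0 , refl
  towards (there (there (here refl)))                         = 2 , refl
  towards (there (there (there (here refl))))                 = 5 , refl
  towards (there (there (there (there (here refl)))))         = 4 , refl
  towards (there (there (there (there (there (here refl)))))) = 1 , refl

Normaliser : Point → Point → Set
Normaliser p q = Σ[ φ ∈ (Point → Point) ] IsEmbedding φ × φ p ≡ east × φ q ≡ origin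

normalise : ∀ {p q} → Adj p q → Normaliser p q
normalise {p} {q} p~q
  with rotate-to-east (subst (Adj (p -ᵖ q)) (-ᵖ-self q) (Adj-preserving (translation-isEmbedding q) {p} {q} p~q))
... | k , east≡ = rotate^ k ∘ (_-ᵖ q) , ∘-isEmbedding (rotate^-isEmbedding k) (translation-isEmbedding q) ,
                  east≡ , trans (cong (rotate^ k) (-ᵖ-self q)) (rotate^-origin k)

-- Bounds on the number of contacts

does⇒ : ∀ {A : Set} (a? : Dec A) → T (does a?) → A
does⇒ (yes a) _ = a

⇒does : ∀ {A : Set} (a? : Dec A) → A → T (does a?)
⇒does (yes _) _ = _
⇒does (no ¬a) a = ¬a a

T-∧-monoʳ : ∀ c {x y} → (T x → T y) → T (c ∧ x) → T (c ∧ y)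
T-∧-monoʳ true x⇒y = x⇒y

indicator-+-mono : ∀ {c c′ m n} → (T c → T c′) → m ≤ n →
                   (if c then 1 else 0) + m ≤ (if c′ then 1 else 0) + n
indicator-+-mono {false} {false} _    m≤n = m≤n
indicator-+-mono {false} {true}  _    m≤n = ℕ.m≤n⇒m≤1+n m≤n
indicator-+-mono {true}  {true}  _    m≤n = s≤s m≤n
indicator-+-mono {true}  {false} c⇒c′ _   = ⊥-elim (c⇒c′ _)

Surrounded : List Point → Point → Set
Surrounded F q = ∀ {r} → Adj q r → r ∈ F

ContactBound : List Point → Point → ℕ → Set
ContactBound F q s = s ≤ 8 ⊎ (s ≤ 9 × Surrounded F q)

ContactBound⇒≤9 : ∀ {F q s} → ContactBound F q s → s ≤ 9
ContactBound⇒≤9 (inj₁ s≤8)       = ℕ.m≤n⇒m≤1+n s≤8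
ContactBound⇒≤9 (inj₂ (s≤9 , _)) = s≤9

extension-bound : ∀ Q {q r R s} → Adj q r → Unique (Q ++ r ∷ R) → ContactBound Q q s → s ≤ 8
extension-bound Q q~r walk! (inj₁ s≤8)              = s≤8
extension-bound Q q~r walk! (inj₂ (_ , surrounded)) = ⊥-elim (unique-++-∉ Q walk! (surrounded q~r))

module _ {φ : Point → Point} (φ-emb : IsEmbedding φ) where

  map-linked : ∀ {P} → Linked Adj P → Linked Adj (map φ P)
  map-linked P~ = Linked.map⁺ (Linked.map (Adj-preserving φ-emb) P~)

  map-unique : ∀ {P} → Unique P → Unique (map φ P)
  map-unique = Unique.map⁺ (injective φ-emb)

  surrounded-pullback : ∀ {F q} → Surrounded (map φ F) (φ q) → Surrounded F q
  surrounded-pullback surrounded q~r with ∈-map⁻ φ (surrounded (Adj-preserving φ-emb q~r))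
  ... | x , x∈F , φr≡φx = subst (_∈ _) (sym (injective φ-emb φr≡φx)) x∈F

  contactBound-pullback : ∀ {F q s s′} → s ≤ s′ → ContactBound (map φ F) (φ q) s′ → ContactBound F q s
  contactBound-pullback s≤s′ (inj₁ s′≤8)                = inj₁ (ℕ.≤-trans s≤s′ s′≤8)
  contactBound-pullback s≤s′ (inj₂ (s′≤9 , surrounded)) =
    inj₂ (ℕ.≤-trans s≤s′ s′≤9 , surrounded-pullback surrounded)

  contactsWith-mono : ∀ a v u S → contactsWith a v u S ≤ contactsWith a (φ v) u (map φ S)
  contactsWith-mono a v []      S       = ℕ.≤-refl
  contactsWith-mono a v (b ∷ u) []      = ℕ.≤-refl
  contactsWith-mono a v (b ∷ u) (q ∷ S) =
    indicator-+-mono (T-∧-monoʳ (isH a) (T-∧-monoʳ (isH b) adjacent⇒adjacent)) (contactsWith-mono a v u S)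
    where adjacent⇒adjacent : T (does (Adj? v q)) → T (does (Adj? (φ v) (φ q)))
          adjacent⇒adjacent = ⇒does (Adj? (φ v) (φ q)) ∘ Adj-preserving φ-emb ∘ does⇒ (Adj? v q)

  contacts-mono : ∀ w P → contacts w P ≤ contacts w (map φ P)
  contacts-mono []      P       = z≤n
  contacts-mono (a ∷ u) []      = z≤n
  contacts-mono (a ∷ u) (v ∷ S) = ℕ.+-mono-≤ first (contacts-mono u S)
    where first : contactsWith a v (drop 1 u) (drop 1 S) ≤ contactsWith a (φ v) (drop 1 u) (drop 1 (map φ S))
          first = subst (λ S′ → _ ≤ contactsWith a (φ v) (drop 1 u) S′) (sym (List.drop-map 1 S))
                        (contactsWith-mono a v (drop 1 u) (drop 1 S))

hydrophobics : Word → ℕ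
hydrophobics []      = 0
hydrophobics (b ∷ u) = (if isH b then 1 else 0) + hydrophobics u

-- A monomer a prepended to u can only touch the hydrophobic monomers of u beyond its successor.
potential : Letter → Word → ℕ
potential a u = if isH a then hydrophobics (drop 1 u) else 0

capacity : Word → Word → ℕ
capacity []       u = 0
capacity (a ∷ rw) u = potential a u + capacity rw (a ∷ u)

contactsWith-≤ : ∀ a v u S → contactsWith a v u S ≤ (if isH a then hydrophobics u else 0)
contactsWith-≤ a v []      S       = z≤n
contactsWith-≤ a v (b ∷ u) []      = z≤n
contactsWith-≤ a v (b ∷ u) (q ∷ S) with isH a | isH b | does (Adj? v q) | contactsWith-≤ a v u S
... | false | _     | _     | ih = ih
... | true  | false | _     | ih = ih
... | true  | true  | true  | ih = s≤s ih
... | true  | true  | false | ih = ℕ.m≤n⇒m≤1+n ih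

contacts-≤-capacity : ∀ rw u P S → length P ≡ length rw →
  contacts (rw ʳ++ u) (P ʳ++ S) ≤ contacts u S + capacity rw u
contacts-≤-capacity []       u []      S _  = ℕ.m≤m+n (contacts u S) 0
contacts-≤-capacity (a ∷ rw) u (v ∷ P) S eq = begin
  contacts (rw ʳ++ a ∷ u) (P ʳ++ v ∷ S)
    ≤⟨ contacts-≤-capacity rw (a ∷ u) P (v ∷ S) (ℕ.suc-injective eq) ⟩
  contactsWith a v (drop 1 u) (drop 1 S) + contacts u S + capacity rw (a ∷ u)
    ≤⟨ ℕ.+-monoˡ-≤ (capacity rw (a ∷ u))
                   (ℕ.+-monoˡ-≤ (contacts u S) (contactsWith-≤ a v (drop 1 u) (drop 1 S))) ⟩
  potential a u + contacts u S + capacity rw (a ∷ u)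
    ≡⟨ cong (_+ capacity rw (a ∷ u)) (ℕ.+-comm (potential a u) (contacts u S)) ⟩
  contacts u S + potential a u + capacity rw (a ∷ u)
    ≡⟨ ℕ.+-assoc (contacts u S) (potential a u) (capacity rw (a ∷ u)) ⟩
  contacts u S + capacity (a ∷ rw) u ∎
  where open ℕ.≤-Reasoning

contactsWith-polarˡ : ∀ v u S → contactsWith P v u S ≡ 0
contactsWith-polarˡ v []      S       = refl
contactsWith-polarˡ v (b ∷ u) []      = refl
contactsWith-polarˡ v (b ∷ u) (q ∷ S) = contactsWith-polarˡ v u S

contactsWith-polarʳ : ∀ a v {u} S → All (_≡ P) u → contactsWith a v u S ≡ 0
contactsWith-polarʳ a v S       All.[]           = refl
contactsWith-polarʳ a v []      (refl All.∷ _)   = refl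
contactsWith-polarʳ a v (q ∷ S) (refl All.∷ u-P) with isH a
... | true  = contactsWith-polarʳ a v S u-P
... | false = contactsWith-polarʳ a v S u-P

contacts-polar : ∀ {u} S → All (_≡ P) u → contacts u S ≡ 0
contacts-polar         S       All.[]           = refl
contacts-polar         []      (refl All.∷ _)   = refl
contacts-polar {_ ∷ u} (v ∷ S) (refl All.∷ u-P) =
  cong₂ _+_ (contactsWith-polarˡ v (drop 1 u) (drop 1 S)) (contacts-polar S u-P)

contactsWith-++-polar : ∀ a v u S {y Q} → All (_≡ P) y → length u ≡ length S →
  contactsWith a v (u ++ y) (S ++ Q) ≡ contactsWith a v u S
contactsWith-++-polar a v []      []      {Q = Q} y-P _  = contactsWith-polarʳ a v Q y-P
contactsWith-++-polar a v (b ∷ u) (q ∷ S) y-P eq =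
  cong (λ n → _ + n) (contactsWith-++-polar a v u S y-P (ℕ.suc-injective eq))

contacts-++-polar : ∀ u S {y Q} → All (_≡ P) y → length u ≡ length S →
  contacts (u ++ y) (S ++ Q) ≡ contacts u S
contacts-++-polar []          []          {Q = Q} y-P _ = contacts-polar Q y-P
contacts-++-polar (a ∷ [])    (v ∷ [])    {Q = Q} y-P _ =
  cong₂ _+_ (contactsWith-polarʳ a v (drop 1 Q) (All.drop⁺ 1 y-P)) (contacts-polar Q y-P)
contacts-++-polar (a ∷ b ∷ u) (v ∷ q ∷ S) y-P eq =
  cong₂ _+_ (contactsWith-++-polar a v u S y-P (ℕ.suc-injective (ℕ.suc-injective eq)))
            (contacts-++-polar (b ∷ u) (q ∷ S) y-P (ℕ.suc-injective eq))

-- Exhaustive search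

leafTest : List Point → ℕ → Bool
leafTest F s = (s ≤ᵇ 8) ∨ ((s ≤ᵇ 9) ∧ all (λ d → does (d ∈? F)) offsets)

everyNeighbour : Point → (Point → Bool) → Bool
everyNeighbour h p = all (λ d → p (h -ᵖ d)) offsets

-- search rw u S s, for a walk S of u listed from its end and s = contacts u S, checks every
-- extension of S by the letters of rw placed in front of u, one at a time, against
-- ContactBound at the origin; branches whose capacity cannot exceed 8 contacts are cut.
search : Word → Word → List Point → ℕ → Bool
extend : Letter → Word → Word → Point → List Point → ℕ → Point → Bool

search []       u F       s = leafTest F s
search (a ∷ rw) u []      s = true
search (a ∷ rw) u (h ∷ S) s = (s + capacity (a ∷ rw) u ≤ᵇ 8) ∨ everyNeighbour h (extend a rw u h S s)

extend a rw u h S s v =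
  does (v ∈? h ∷ S) ∨ search rw (a ∷ u) (v ∷ h ∷ S) (contactsWith a v (drop 1 u) S + s)

all-offsets : ∀ (p : Point → Bool) → T (all p offsets) → ∀ {d} → d ∈ offsets → T (p d)
all-offsets p ok = All.lookup (All.all⁺ p offsets ok)

leafTest-sound : ∀ F s → T (leafTest F s) → ContactBound F origin s
leafTest-sound F s ok with Equivalence.to T-∨ ok
... | inj₁ s≤8 = inj₁ (ℕ.≤ᵇ⇒≤ s 8 s≤8)
... | inj₂ ok′ with Equivalence.to (T-∧ {s ≤ᵇ 9}) ok′
...   | s≤9 , occupied = inj₂ (ℕ.≤ᵇ⇒≤ s 9 s≤9 , surrounded)
  where
  surrounded : Surrounded F origin
  surrounded {r} o~r =
    subst (_∈ F) (-ᵖ-origin r) (does⇒ (r -ᵖ origin ∈? F) (all-offsets (λ d → does (d ∈? F)) occupied o~r))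

everyNeighbour-sound : ∀ {h p v} → T (everyNeighbour h p) → Adj v h → T (p v)
everyNeighbour-sound {h} {p} {v} ok v~h =
  subst (T ∘ p) (-ᵖ-involutive h v) (all-offsets (λ d → p (h -ᵖ d)) ok v~h)

search-sound : ∀ rw u h S P → length P ≡ length rw →
  Linked Adj (P ʳ++ h ∷ S) → Unique (P ʳ++ h ∷ S) →
  search rw u (h ∷ S) (contacts u (h ∷ S)) ≡ true →
  ContactBound (P ʳ++ h ∷ S) origin (contacts (rw ʳ++ u) (P ʳ++ h ∷ S))
search-sound []       u h S []      _  _     _     ok = leafTest-sound (h ∷ S) _ (Equivalence.from T-≡ ok)
search-sound (a ∷ rw) u h S (v ∷ P) eq walk~ walk! ok with Equivalence.to T-∨ (Equivalence.from T-≡ ok)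
... | inj₁ pruned   =
  inj₁ (ℕ.≤-trans (contacts-≤-capacity (a ∷ rw) u (v ∷ P) (h ∷ S) eq) (ℕ.≤ᵇ⇒≤ _ 8 pruned))
... | inj₂ branches = search-sound rw (a ∷ u) v (h ∷ S) P (ℕ.suc-injective eq) walk~ walk! extended
  where
  v∉ : v ∉ h ∷ S
  v∉ = Unique.Unique[x∷xs]⇒x∉xs (unique-ʳ++⁻ʳ P walk!)
  extended : search rw (a ∷ u) (v ∷ h ∷ S) (contacts (a ∷ u) (v ∷ h ∷ S)) ≡ true
  extended with Equivalence.to T-∨
                  (everyNeighbour-sound {h} {extend a rw u h S _} branches (Linked.head (linked-ʳ++⁻ʳ P walk~)))
  ... | inj₁ v∈   = ⊥-elim (v∉ (does⇒ (v ∈? h ∷ S) v∈))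
  ... | inj₂ done = Equivalence.to T-≡ done

-- The counterexample

x₀ : Word
x₀ = H ∷ P ∷ H ∷ H ∷ P ∷ H ∷ H ∷ P ∷ H ∷ H ∷ []

x₀-search : search (reverse (take 8 x₀)) (drop 8 x₀) (east ∷ origin ∷ [])
                   (contacts (drop 8 x₀) (east ∷ origin ∷ [])) ≡ true
x₀-search = refl

x₀-normalised-bound : ∀ {q₀ q₁ q₂ q₃ q₄ q₅ q₆ q₇ q₈ q₉} → q₈ ≡ east → q₉ ≡ origin →
  let Q = q₀ ∷ q₁ ∷ q₂ ∷ q₃ ∷ q₄ ∷ q₅ ∷ q₆ ∷ q₇ ∷ q₈ ∷ q₉ ∷ [] in
  Linked Adj Q → Unique Q → ContactBound Q q₉ (contacts x₀ Q)
x₀-normalised-bound {q₀} {q₁} {q₂} {q₃} {q₄} {q₅} {q₆} {q₇} refl refl Q~ Q! =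
  search-sound (reverse (take 8 x₀)) (drop 8 x₀) east (origin ∷ [])
               (q₇ ∷ q₆ ∷ q₅ ∷ q₄ ∷ q₃ ∷ q₂ ∷ q₁ ∷ q₀ ∷ []) refl Q~ Q! x₀-search

x₀-walk-bound-via : ∀ {q₀ q₁ q₂ q₃ q₄ q₅ q₆ q₇ q₈ q₉} → Normaliser q₈ q₉ →
  let Q = q₀ ∷ q₁ ∷ q₂ ∷ q₃ ∷ q₄ ∷ q₅ ∷ q₆ ∷ q₇ ∷ q₈ ∷ q₉ ∷ [] in
  Linked Adj Q → Unique Q → ContactBound Q q₉ (contacts x₀ Q)
x₀-walk-bound-via {q₀} {q₁} {q₂} {q₃} {q₄} {q₅} {q₆} {q₇} {q₈} {q₉}
                  (φ , φ-emb , φq₈≡east , φq₉≡origin) Q~ Q! =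
  contactBound-pullback φ-emb (contacts-mono φ-emb x₀ Q)
    (x₀-normalised-bound φq₈≡east φq₉≡origin (map-linked φ-emb Q~) (map-unique φ-emb Q!))
  where Q = q₀ ∷ q₁ ∷ q₂ ∷ q₃ ∷ q₄ ∷ q₅ ∷ q₆ ∷ q₇ ∷ q₈ ∷ q₉ ∷ []

x₀-walk-bound : ∀ {q₀ q₁ q₂ q₃ q₄ q₅ q₆ q₇ q₈ q₉} →
  let Q = q₀ ∷ q₁ ∷ q₂ ∷ q₃ ∷ q₄ ∷ q₅ ∷ q₆ ∷ q₇ ∷ q₈ ∷ q₉ ∷ [] in
  Linked Adj Q → Unique Q → ContactBound Q q₉ (contacts x₀ Q)
x₀-walk-bound Q~@(_ ∷ _ ∷ _ ∷ _ ∷ _ ∷ _ ∷ _ ∷ _ ∷ q₈~q₉ ∷ [-]) = x₀-walk-bound-via (normalise q₈~q₉) Q~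

x₀-polar-walk-bound : ∀ {y q₀ q₁ q₂ q₃ q₄ q₅ q₆ q₇ q₈ q₉ r R} → All (_≡ P) y →
  let Q = q₀ ∷ q₁ ∷ q₂ ∷ q₃ ∷ q₄ ∷ q₅ ∷ q₆ ∷ q₇ ∷ q₈ ∷ q₉ ∷ [] in
  Linked Adj (Q ++ r ∷ R) → Unique (Q ++ r ∷ R) → contacts (x₀ ++ y) (Q ++ r ∷ R) ≤ 8
x₀-polar-walk-bound {y} {q₀} {q₁} {q₂} {q₃} {q₄} {q₅} {q₆} {q₇} {q₈} {q₉} y-P walk~ walk! =
  ℕ.≤-trans (ℕ.≤-reflexive (contacts-++-polar x₀ Q y-P refl))
    (extension-bound Q (linked-junction (q₀ ∷ q₁ ∷ q₂ ∷ q₃ ∷ q₄ ∷ q₅ ∷ q₆ ∷ q₇ ∷ q₈ ∷ []) walk~)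
                     walk!
      (x₀-walk-bound (linked-++⁻ˡ Q walk~) (unique-++⁻ˡ Q walk!)))
  where Q = q₀ ∷ q₁ ∷ q₂ ∷ q₃ ∷ q₄ ∷ q₅ ∷ q₆ ∷ q₇ ∷ q₈ ∷ q₉ ∷ []

x₀-score-≤9 : (f : Fold x₀) → score x₀ f ≤ 9
x₀-score-≤9 f = subst (_≤ 9) (sym (score≡contacts x₀ f))
  (ContactBound⇒≤9 (x₀-walk-bound (positions-linked f) (positions-unique f)))

x₀-polar-score-≤8 : ∀ {b y} → All (_≡ P) (b ∷ y) →
                    (f : Fold (x₀ ++ b ∷ y)) → score (x₀ ++ b ∷ y) f ≤ 8
x₀-polar-score-≤8 {b} {y} by-P f = subst (_≤ 8) (sym (score≡contacts (x₀ ++ b ∷ y) f))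
  (x₀-polar-walk-bound by-P (positions-linked f) (positions-unique f))

walk₉ : List Point
walk₉ = (+ 0 , + 1) ∷ (+ 1 , + 1) ∷ (+ 1 , + 0) ∷ (+ 1 , -[1+ 0 ]) ∷ (+ 1 , -[1+ 1 ]) ∷
        (+ 0 , -[1+ 0 ]) ∷ (-[1+ 0 ] , + 0) ∷ (-[1+ 1 ] , + 1) ∷ (-[1+ 0 ] , + 1) ∷ (+ 0 , + 0) ∷ []

x₀-fold₉ : Fold x₀
x₀-fold₉ = walkFold walk₉ refl (from-yes (Linked.linked? Adj? walk₉)) (from-yes (unique? walk₉))

x₀-fold₉-score : score x₀ x₀-fold₉ ≡ 9
x₀-fold₉-score = refl

walk₈ : List Point
walk₈ = (+ 1 , + 0) ∷ (+ 2 , + 0) ∷ (+ 2 , -[1+ 0 ]) ∷ (+ 3 , -[1+ 0 ]) ∷ (+ 4 , -[1+ 1 ]) ∷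
        (+ 3 , -[1+ 1 ]) ∷ (+ 2 , -[1+ 1 ]) ∷ (+ 1 , -[1+ 1 ]) ∷ (+ 1 , -[1+ 0 ]) ∷ (+ 0 , + 0) ∷ []

north : ℕ → Point
north t = (+ 0 , + suc t)

northRay : ℕ → List Point
northRay = applyUpTo north

northRay-linked : ∀ k → Linked Adj (northRay k)
northRay-linked k = Linked.applyUpTo⁺₂ north k step
  where
  step : ∀ t → Adj (north t) (north (suc t))
  step t = subst (λ z → (+ 0 , z) ∈ offsets) (sym (one-more (+ suc t))) (there (there (here refl)))
    where one-more : ∀ i → (+ 1 ℤ.+ i) ℤ.- i ≡ + 1
          one-more = ℤ-Ring.solve-∀

northRay-unique : ∀ k → Unique (northRay k)
northRay-unique k =
  Unique.applyUpTo⁺₁ north k (λ s<t _ e → ℕ.<⇒≢ s<t (ℕ.suc-injective (ℤP.+-injective (cong proj₂ e))))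

walk₈-northRay-disjoint : ∀ k {v} → v ∈ walk₈ → v ∉ northRay k
walk₈-northRay-disjoint k v∈walk₈ v∈ray with ∈-applyUpTo⁻ north v∈ray
... | t , _ , refl with All.lookup (from-yes (All.all? (λ p → proj₂ p ℤ.≤? + 0) walk₈)) v∈walk₈
...   | ℤ.+≤+ ()

walk₈-northRay-linked : ∀ k → Linked Adj (walk₈ ++ northRay k)
walk₈-northRay-linked k = Linked.++⁺ (from-yes (Linked.linked? Adj? walk₈)) (junction k) (northRay-linked k)
  where
  junction : ∀ k → Connected Adj (just origin) (head (northRay k))
  junction zero    = just-nothing
  junction (suc k) = just (there (there (here refl)))

walk₈-northRay-unique : ∀ k → Unique (walk₈ ++ northRay k)
walk₈-northRay-unique k = Unique.++⁺ (from-yes (unique? walk₈)) (northRay-unique k)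
  (λ (v∈walk₈ , v∈ray) → walk₈-northRay-disjoint k v∈walk₈ v∈ray)

x₀-polar-length : ∀ k → length (x₀ ++ replicate k P) ≡ length (walk₈ ++ northRay k)
x₀-polar-length k = cong (λ n → 10 + n) (trans (List.length-replicate k) (sym (List.length-applyUpTo north k)))

x₀-polar-fold₈ : ∀ k → Fold (x₀ ++ replicate k P)
x₀-polar-fold₈ k =
  walkFold (walk₈ ++ northRay k) (x₀-polar-length k) (walk₈-northRay-linked k) (walk₈-northRay-unique k)

x₀-polar-fold₈-score : ∀ k → score (x₀ ++ replicate k P) (x₀-polar-fold₈ k) ≡ 8
x₀-polar-fold₈-score k =
  trans (score-walkFold {x₀ ++ replicate k P} (walk₈ ++ northRay k)
                        (x₀-polar-length k) (walk₈-northRay-linked k) (walk₈-northRay-unique k))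
        (contacts-++-polar x₀ walk₈ (All.replicate⁺ k refl) refl)

theorem2p14 : (N : ℕ) → Σ Word λ x → Σ Word λ y → (N ≤ length x + length y) ×
    Σ ℕ (λ a → Σ ℕ (λ b → IsJtri (x ++ y) a × IsJtri x b × a < b))
theorem2p14 N = x₀ , replicate (suc N) P , long , 8 , 9 , J-x₀y , J-x₀ , ℕ.n<1+n 8
  where
  long : N ≤ length x₀ + length (replicate (suc N) P)
  long = subst (λ n → N ≤ 10 + n) (sym (List.length-replicate (suc N)))
               (ℕ.≤-trans (ℕ.n≤1+n N) (ℕ.m≤n+m (suc N) 10))
  J-x₀ : IsJtri x₀ 9
  J-x₀ = (x₀-fold₉ , x₀-fold₉-score) , x₀-score-≤9
  J-x₀y : IsJtri (x₀ ++ replicate (suc N) P) 8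
  J-x₀y = (x₀-polar-fold₈ (suc N) , x₀-polar-fold₈-score (suc N)) ,
          x₀-polar-score-≤8 (All.replicate⁺ (suc N) refl)
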